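{- A quasivariety $\mathcal Q$ is passive structurally complete if and only if every non-negative passive admissible universal sentence is valid in $\mathcal Q$.
   Context: For a quasivariety $\mathcal Q$ let $\mathbf F_{\mathcal Q}(\omega)$ be its free algebra on countably many generators. A universal sentence $\Sigma\Rightarrow\Delta$ ($\Sigma,\Delta$ finite sets of equations) is valid in an algebra if every assignment satisfying all of $\Sigma$ satisfies some equation of $\Delta$; it is non-negative if $\Delta\ne\emptyset$ and a quasiequation if $|\Delta|=1$. A substitution (homomorphism from terms to $\mathbf F_{\mathcal Q}(\omega)$) unifies $\Sigma$ if it identifies both sides of each of its equations; $\Sigma\Rightarrow\Delta$ is admissible in $\mathcal Q$ if every substitution unifying $\Sigma$ unifies some equation of $\Delta$, and passive if no substitution unifies $\Sigma$. $\mathcal Q$ is passive structurally complete if every passive admissible quasiequation is valid in $\mathcal Q$. -}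

module Defs where

open import Data.Nat using (ℕ)
open import Data.Fin using (Fin)
open import Data.Product using (_×_; _,_)
open import Data.List using (List; [])
open import Data.List.Relation.Unary.All using (All)
open import Data.List.Relation.Unary.Any using (Any)
open import Relation.Binary.PropositionalEquality using (_≡_)
open import Relation.Nullary using (¬_)
open import Data.Nat using (ℕ)
open import Data.List using (length)

record Signature : Set₁ where
  field
    Op : Set
    ar : Op → ℕ

module _ (S : Signature) where
  open Signature S

  data Term : Set where
    var : ℕ → Term
    op  : (o : Op) → (Fin (ar o) → Term) → Term

  Equation : Set
  Equation = Term × Term

  record Algebra : Set₁ where
    field
      Carrier : Set
      interp  : (o : Op) → (Fin (ar o) → Carrier) → Carrier

  open Algebra public

  eval : (A : Algebra) → (ℕ → Carrier A) → Term → Carrier A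
  eval A ρ (var x)   = ρ x
  eval A ρ (op o ts) = interp A o (λ i → eval A ρ (ts i))

  Sat : (A : Algebra) → (ℕ → Carrier A) → Equation → Set
  Sat A ρ (s , t) = eval A ρ s ≡ eval A ρ t

  record UnivSentence : Set where
    constructor _⇒_
    field
      hyp   : List Equation
      concl : List Equation

  open UnivSentence public

  IsQuasiequation : UnivSentence → Set
  IsQuasiequation u = length (concl u) ≡ 1

  NonNegative : UnivSentence → Set
  NonNegative u = ¬ (concl u ≡ [])

  ValidIn : Algebra → UnivSentence → Set
  ValidIn A u = ∀ (ρ : ℕ → Carrier A) → All (Sat A ρ) (hyp u) → Any (Sat A ρ) (concl u)

  -- A quasivariety: the class of models of a set of quasiequations.
  record Quasivariety : Set₁ where
    field
      axioms       : UnivSentence → Set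
      axioms-quasi : ∀ u → axioms u → IsQuasiequation u

  open Quasivariety public

  _∈Q_ : Algebra → Quasivariety → Set
  A ∈Q Q = ∀ u → axioms Q u → ValidIn A u

  ValidInQ : Quasivariety → UnivSentence → Set₁
  ValidInQ Q u = ∀ (A : Algebra) → A ∈Q Q → ValidIn A u

  -- Equality in the free algebra F_Q(ω) = Term / (identities of Q):
  -- two terms are identified iff Q satisfies the identity s ≈ t.
  FreeEq : Quasivariety → Term → Term → Set₁
  FreeEq Q s t = ∀ (A : Algebra) → A ∈Q Q → ∀ (ρ : ℕ → Carrier A) → eval A ρ s ≡ eval A ρ t

  -- substitutions: homomorphisms Term → F_Q(ω), given by images of variables
  Substitution : Set
  Substitution = ℕ → Term

  _⟪_⟫ : Term → Substitution → Term
  var x ⟪ σ ⟫   = σ x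
  op o ts ⟪ σ ⟫ = op o (λ i → ts i ⟪ σ ⟫)

  Unifies : Quasivariety → Substitution → Equation → Set₁
  Unifies Q σ (s , t) = FreeEq Q (s ⟪ σ ⟫) (t ⟪ σ ⟫)

  Admissible : Quasivariety → UnivSentence → Set₁
  Admissible Q u = ∀ (σ : Substitution) → All (Unifies Q σ) (hyp u) → Any (Unifies Q σ) (concl u)

  Passive : Quasivariety → UnivSentence → Set₁
  Passive Q u = ∀ (σ : Substitution) → ¬ All (Unifies Q σ) (hyp u)

  PassiveStructurallyComplete : Quasivariety → Set₁
  PassiveStructurallyComplete Q =
    ∀ (u : UnivSentence) → IsQuasiequation u → Passive Q u → Admissible Q u → ValidInQ Q u

{-# OPTIONS --safe #-}
-- No substitution unifies the premises of a passive sentence, so every passive sentence is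
-- admissible. Hence a passive structurally complete quasivariety validates every passive
-- quasiequation Σ ⇒ d, and therefore every passive sentence Σ ⇒ Δ with d ∈ Δ; conversely
-- quasiequations are non-negative.
module Submission where

open import Defs
open import Data.Product using (_×_; _,_)
open import Data.List using ([]; _∷_; [_])
open import Data.List.Relation.Unary.Any using (here)
open import Data.List.Relation.Binary.Subset.Propositional using (_⊆_)
open import Data.List.Relation.Binary.Subset.Propositional.Properties using (Any-resp-⊆)
open import Data.Empty using (⊥-elim)
open import Relation.Binary.PropositionalEquality using (refl)

[x]⊆x∷xs : ∀ {a} {A : Set a} (x : A) xs → [ x ] ⊆ x ∷ xs
[x]⊆x∷xs x xs (here refl) = here refl

module _ (S : Signature) where

  passive⇒admissible : ∀ Q (u : UnivSentence S) → Passive S Q u → Admissible S Q u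
  passive⇒admissible Q u passive σ unifiesHyp = ⊥-elim (passive σ unifiesHyp)

  quasiequation⇒nonNegative : ∀ (u : UnivSentence S) → IsQuasiequation S u → NonNegative S u
  quasiequation⇒nonNegative (Σ ⇒ []) ()
  quasiequation⇒nonNegative (Σ ⇒ (_ ∷ _)) _ ()

  validInQ-weakenConcl : ∀ Q Σ {Δ Δ′} → Δ ⊆ Δ′ → ValidInQ S Q (Σ ⇒ Δ) → ValidInQ S Q (Σ ⇒ Δ′)
  validInQ-weakenConcl Q Σ Δ⊆Δ′ valid A A∈Q ρ satHyp = Any-resp-⊆ Δ⊆Δ′ (valid A A∈Q ρ satHyp)

  passiveStructurallyComplete⇒passiveValid : ∀ Q → PassiveStructurallyComplete S Q →
    ∀ (u : UnivSentence S) → NonNegative S u → Passive S Q u → ValidInQ S Q u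
  passiveStructurallyComplete⇒passiveValid Q psc (Σ ⇒ []) nonNegative _ = ⊥-elim (nonNegative refl)
  passiveStructurallyComplete⇒passiveValid Q psc (Σ ⇒ (d ∷ Δ)) _ passive =
    validInQ-weakenConcl Q Σ ([x]⊆x∷xs d Δ)
      (psc (Σ ⇒ [ d ]) refl passive (passive⇒admissible Q (Σ ⇒ [ d ]) passive))

proposition4p20 : (S : Signature) (Q : Quasivariety S)
    → (PassiveStructurallyComplete S Q
        → ∀ (u : UnivSentence S) → NonNegative S u → Passive S Q u → Admissible S Q u → ValidInQ S Q u)
    × ((∀ (u : UnivSentence S) → NonNegative S u → Passive S Q u → Admissible S Q u → ValidInQ S Q u)
        → PassiveStructurallyComplete S Q)
proposition4p20 S Q =
  (λ psc u nonNegative passive _ → passiveStructurallyComplete⇒passiveValid S Q psc u nonNegative passive) ,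
  (λ passiveValid u quasi → passiveValid u (quasiequation⇒nonNegative S u quasi))
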